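{- Let $n$ and $k$ be positive integers. The equation $(k!)^n-k^{n!}=(n!)^k-n^{k!}$ holds if and only if $k=n$ or $(k,n)\in\{(1,2),(2,1)\}$. -}

module Defs where

{-# OPTIONS --safe #-}
-- Moving the subtracted terms across, the equation says Φ k n ≡ Φ n k for
-- Φ k n = (k !) ^ n + n ^ (k !).  If 2 ≤ k < n and n ≥ 4, then k ! ≤ k ^ k and
-- n ≤ 2 ^ (n - 1) ≤ k ^ (n - 1) turn both terms of Φ k n into powers of k whose
-- exponents k * n and (n - 1) * k ! are below n !, so Φ k n ≤ k ^ (n !) < Φ n k.
-- The remaining cases with k < n are k = 1, where Φ 1 n = 1 + n and Φ n 1 = n ! + 1,
-- and (k , n) = (2 , 3), where the two sides are 17 and 100.
module Submission where

open import Defs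
open import Data.Nat using (ℕ; zero; suc; _+_; _*_; _<_; _≤_; _^_; _!; z≤n; s≤s)
open import Data.Nat.Properties
open import Data.Integer using (ℤ; +_; _-_)
import Data.Integer as ℤ
import Data.Integer.Properties as ℤ
open import Data.Integer.Tactic.RingSolver using (solve-∀)
open import Data.Product using (_×_; _,_; swap)
open import Data.Sum using (_⊎_; inj₁; inj₂)
open import Data.Empty using (⊥-elim)
open import Function.Bundles using (_⇔_; mk⇔)
open import Relation.Binary.Definitions using (tri<; tri≈; tri>)
open import Relation.Binary.PropositionalEquality using (_≡_; refl; sym; cong; cong₂; module ≡-Reasoning)

+m-+n≡+p-+q⇒m+q≡p+n : ∀ m n p q → + m - + n ≡ + p - + q → m + q ≡ p + n
+m-+n≡+p-+q⇒m+q≡p+n m n p q eq = ℤ.+-injective (begin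
  + (m + q)                       ≡⟨ ℤ.pos-+ m q ⟩
  + m ℤ.+ + q                     ≡⟨ sub-add-cancel (+ m) (+ n) (+ q) ⟨
  (+ m - + n) ℤ.+ (+ n ℤ.+ + q)   ≡⟨ cong (ℤ._+ (+ n ℤ.+ + q)) eq ⟩
  (+ p - + q) ℤ.+ (+ n ℤ.+ + q)   ≡⟨ cong (λ x → (+ p - + q) ℤ.+ x) (ℤ.+-comm (+ n) (+ q)) ⟩
  (+ p - + q) ℤ.+ (+ q ℤ.+ + n)   ≡⟨ sub-add-cancel (+ p) (+ q) (+ n) ⟩
  + p ℤ.+ + n                     ≡⟨ ℤ.pos-+ p n ⟨
  + (p + n)                       ∎)
  where
  open ≡-Reasoning
  sub-add-cancel : ∀ (x y z : ℤ) → (x - y) ℤ.+ (y ℤ.+ z) ≡ x ℤ.+ z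
  sub-add-cancel = solve-∀

n!≤n^n : ∀ n → n ! ≤ n ^ n
n!≤n^n zero    = ≤-refl
n!≤n^n (suc n) = *-monoʳ-≤ (suc n) (≤-trans (n!≤n^n n) (^-monoˡ-≤ n (n≤1+n n)))

!-mono-≤ : ∀ {m n} → m ≤ n → m ! ≤ n !
!-mono-≤ {n = n} z≤n = 1≤n! n
!-mono-≤ (s≤s m≤n)   = *-mono-≤ (s≤s m≤n) (!-mono-≤ m≤n)

n<n! : ∀ {n} → 3 ≤ n → n < n !
n<n! {suc n} (s≤s 2≤n) = m<m*n (suc n) (n !) (!-mono-≤ 2≤n)

n<2^n : ∀ n → n < 2 ^ n
n<2^n zero    = s≤s z≤n
n<2^n (suc n) = begin-strict
  suc n           <⟨ +-mono-≤ (m^n>0 2 n) (n<2^n n) ⟩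
  2 ^ n + 2 ^ n   ≡⟨ cong (_+_ (2 ^ n)) (+-identityʳ (2 ^ n)) ⟨
  2 ^ suc n       ∎
  where open ≤-Reasoning

m^i+m^j≤m^n : ∀ m {i j n} → 2 ≤ m → i < n → j < n → m ^ i + m ^ j ≤ m ^ n
m^i+m^j≤m^n m@(suc _) {i} {j} {suc n} 2≤m (s≤s i≤n) (s≤s j≤n) = begin
  m ^ i + m ^ j   ≤⟨ +-mono-≤ (^-monoʳ-≤ m i≤n) (^-monoʳ-≤ m j≤n) ⟩
  m ^ n + m ^ n   ≡⟨ cong (_+_ (m ^ n)) (+-identityʳ (m ^ n)) ⟨
  2 * m ^ n       ≤⟨ *-monoˡ-≤ (m ^ n) 2≤m ⟩
  m * m ^ n       ∎
  where open ≤-Reasoning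

Φ : ℕ → ℕ → ℕ
Φ k n = (k !) ^ n + n ^ (k !)

Φ[1,n]<Φ[n,1] : ∀ {n} → 3 ≤ n → Φ 1 n < Φ n 1
Φ[1,n]<Φ[n,1] {n} 3≤n = begin-strict
  1 ^ n + n ^ 1           ≡⟨ cong₂ _+_ (^-zeroˡ n) (^-identityʳ n) ⟩
  1 + n                   <⟨ +-monoʳ-< 1 (n<n! 3≤n) ⟩
  1 + n !                 ≡⟨ +-comm 1 (n !) ⟩
  n ! + 1                 ≡⟨ cong₂ _+_ (^-identityʳ (n !)) (^-zeroˡ (n !)) ⟨
  (n !) ^ 1 + 1 ^ (n !)   ∎
  where open ≤-Reasoning

Φ<Φ-swap : ∀ {k n} → 2 ≤ k → k < n → 4 ≤ n → Φ k n < Φ n k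
Φ<Φ-swap {k} {n@(suc m)} 2≤k (s≤s k≤m) (s≤s 3≤m) = begin-strict
  (k !) ^ n + n ^ (k !)         ≤⟨ +-mono-≤ [k!]^n≤k^[k*n] n^[k!]≤k^[m*k!] ⟩
  k ^ (k * n) + k ^ (m * k !)   ≤⟨ m^i+m^j≤m^n k 2≤k k*n<n! m*k!<n! ⟩
  k ^ (n !)                     <⟨ m<n+m (k ^ (n !)) (m^n>0 (n !) {{n !≢0}} k) ⟩
  (n !) ^ k + k ^ (n !)         ∎
  where
  open ≤-Reasoning
  [k!]^n≤k^[k*n] : (k !) ^ n ≤ k ^ (k * n)
  [k!]^n≤k^[k*n] = begin
    (k !) ^ n     ≤⟨ ^-monoˡ-≤ n (n!≤n^n k) ⟩
    (k ^ k) ^ n   ≡⟨ ^-*-assoc k k n ⟩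
    k ^ (k * n)   ∎
  n^[k!]≤k^[m*k!] : n ^ (k !) ≤ k ^ (m * k !)
  n^[k!]≤k^[m*k!] = begin
    n ^ (k !)         ≤⟨ ^-monoˡ-≤ (k !) (≤-trans (n<2^n m) (^-monoˡ-≤ m 2≤k)) ⟩
    (k ^ m) ^ (k !)   ≡⟨ ^-*-assoc k m (k !) ⟩
    k ^ (m * k !)     ∎
  k*n<n! : k * n < n !
  k*n<n! = begin-strict
    k * n     ≡⟨ *-comm k n ⟩
    n * k     <⟨ *-monoʳ-< n (≤-<-trans k≤m (n<n! 3≤m)) ⟩
    n * m !   ∎
  m*k!<n! : m * k ! < n !
  m*k!<n! = begin-strict
    m * k !         ≤⟨ *-monoʳ-≤ m (!-mono-≤ k≤m) ⟩
    m * m !         <⟨ m<n+m (m * m !) (1≤n! m) ⟩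
    m ! + m * m !   ∎

Φ≡Φ-swap⇒k≡1×n≡2 : ∀ {k n} → 1 ≤ k → k < n → Φ k n ≡ Φ n k → k ≡ 1 × n ≡ 2
Φ≡Φ-swap⇒k≡1×n≡2 {suc zero}          {suc zero}                   _ (s≤s ()) _
Φ≡Φ-swap⇒k≡1×n≡2 {suc zero}          {suc (suc zero)}             _ _ _ = refl , refl
Φ≡Φ-swap⇒k≡1×n≡2 {suc zero}          {n@(suc (suc (suc _)))}      _ _ eq =
  ⊥-elim (<⇒≢ (Φ[1,n]<Φ[n,1] {n} (s≤s (s≤s (s≤s z≤n)))) eq)
Φ≡Φ-swap⇒k≡1×n≡2 {suc (suc _)}       {suc zero}                   _ (s≤s ()) _
Φ≡Φ-swap⇒k≡1×n≡2 {suc (suc _)}       {suc (suc zero)}             _ (s≤s (s≤s ())) _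
Φ≡Φ-swap⇒k≡1×n≡2 {suc (suc zero)}    {suc (suc (suc zero))}       _ _ ()
Φ≡Φ-swap⇒k≡1×n≡2 {suc (suc (suc _))} {suc (suc (suc zero))}       _ (s≤s (s≤s (s≤s ()))) _
Φ≡Φ-swap⇒k≡1×n≡2 {suc (suc _)}       {suc (suc (suc (suc _)))}    _ k<n eq =
  ⊥-elim (<⇒≢ (Φ<Φ-swap (s≤s (s≤s z≤n)) k<n (s≤s (s≤s (s≤s (s≤s z≤n))))) eq)

theorem1p3 : (n k : ℕ) → 1 ≤ n → 1 ≤ k →
    ((+ ((k !) ^ n)) - (+ (k ^ (n !))) ≡ (+ ((n !) ^ k)) - (+ (n ^ (k !))))
      ⇔ (k ≡ n ⊎ ((k ≡ 1 × n ≡ 2) ⊎ (k ≡ 2 × n ≡ 1)))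
theorem1p3 n k 1≤n 1≤k = mk⇔ to from
  where
  to : + ((k !) ^ n) - + (k ^ (n !)) ≡ + ((n !) ^ k) - + (n ^ (k !)) →
       k ≡ n ⊎ ((k ≡ 1 × n ≡ 2) ⊎ (k ≡ 2 × n ≡ 1))
  to eq with <-cmp k n | +m-+n≡+p-+q⇒m+q≡p+n ((k !) ^ n) (k ^ (n !)) ((n !) ^ k) (n ^ (k !)) eq
  ... | tri< k<n _ _ | Φ≡ = inj₂ (inj₁ (Φ≡Φ-swap⇒k≡1×n≡2 {k} {n} 1≤k k<n Φ≡))
  ... | tri≈ _ k≡n _ | _  = inj₁ k≡n
  ... | tri> _ _ n<k | Φ≡ = inj₂ (inj₂ (swap (Φ≡Φ-swap⇒k≡1×n≡2 {n} {k} 1≤n n<k (sym Φ≡))))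
  from : k ≡ n ⊎ ((k ≡ 1 × n ≡ 2) ⊎ (k ≡ 2 × n ≡ 1)) →
         + ((k !) ^ n) - + (k ^ (n !)) ≡ + ((n !) ^ k) - + (n ^ (k !))
  from (inj₁ refl)                 = refl
  from (inj₂ (inj₁ (refl , refl))) = refl
  from (inj₂ (inj₂ (refl , refl))) = refl
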